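{- For integers $n\ge1$ and $k\ge1$, let $b_{nk}$ be the number of chains of length $k$ in $L_n$ that contain both $\emptyset$ and $[n]$, and let $p_{ni}$ be the number of arithmetic progressions of size $i$ contained in $[n]$. Then $b_{n1}=1$ for all $n\ge1$, $b_{nk}=0$ whenever $k>n$, and for $2\le k\le n$, $$b_{nk}=\sum_{i=1}^{n-1}p_{ni}\,b_{i(k-1)}.$$
   Context: $L_n$ is the set of all subsets of $[n]=\{1,\ldots,n\}$ that are arithmetic progressions $\{a,a+r,\ldots,a+(k-1)r\}$ ($a$, $r\ge1$, $k\ge0$ integers; including $\emptyset$, singletons and $2$-element subsets), ordered by inclusion. A chain of length $k$ in a poset is a set $\{x_1,\ldots,x_{k+1}\}$ with $x_1<x_2<\cdots<x_{k+1}$. -}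

module Defs where

open import Data.Nat using (ℕ; zero; suc; _+_; _*_; _≤_; _<_)
open import Data.Fin using (Fin; toℕ; inject₁; fromℕ)
  renaming (zero to fzero; suc to fsuc)
open import Data.Fin.Subset using (Subset; _∈_; _⊂_; ∣_∣; ⊥; ⊤)
open import Data.Vec using (Vec; lookup)
open import Data.Product using (Σ; ∃; _×_)
open import Data.Irrelevant using (Irrelevant)
open import Function.Bundles using (_⇔_)
open import Relation.Binary.PropositionalEquality using (_≡_)

-- A subset of [n] = {1,…,n} is a Subset n; Fin-index x stands for the
-- integer toℕ x + 1.

_∈ℕ_ : {n : ℕ} → ℕ → Subset n → Set
_∈ℕ_ {n} m s = Σ (Fin n) (λ x → (suc (toℕ x) ≡ m) × (x ∈ s))

IsAP : {n : ℕ} → Subset n → Set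
IsAP s = ∃ λ a → ∃ λ r → ∃ λ k →
  (1 ≤ a) × (1 ≤ r) × (∀ m → (m ∈ℕ s) ⇔ (∃ λ j → (j < k) × (m ≡ a + j * r)))

-- A chain of length k in L_n containing ∅ and [n]:
-- x₀ < x₁ < … < x_k in L_n (strict inclusion) with x₀ = ∅ and x_k = [n].
-- (Since the elements are strictly increasing, such chains as sets are in
-- bijection with such increasing sequences.)
IsChainEmptyFull : (n k : ℕ) → Vec (Subset n) (suc k) → Set
IsChainEmptyFull n k v =
  (∀ (i : Fin (suc k)) → IsAP (lookup v i)) ×
  (∀ (i : Fin k) → lookup v (inject₁ i) ⊂ lookup v (fsuc i)) ×
  (lookup v fzero ≡ ⊥) ×
  (lookup v (fromℕ k) ≡ ⊤)

-- The type of such chains (proof components are irrelevant, so the type is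
-- in bijection with the set of chains).
Chain : ℕ → ℕ → Set
Chain n k = Σ (Vec (Subset n) (suc k)) (λ v → Irrelevant (IsChainEmptyFull n k v))

APofSize : ℕ → ℕ → Set
APofSize n i = Σ (Subset n) (λ s → Irrelevant (IsAP s × (∣ s ∣ ≡ i)))

sum1to : ℕ → (ℕ → ℕ) → ℕ
sum1to zero f = 0
sum1to (suc m) f = sum1to m f + f (suc m)

-- Removing the top element [n] from a chain ∅ = x₀ ⊂ ⋯ ⊂ x_k = [n] (k ≥ 2) leaves a chain
-- from ∅ to the proper progression s = x_{k-1}. The increasing enumeration of s identifies
-- the subsets of s with the subsets of [|s|]; when s = {a, a+r, …} it is the affine map
-- j ↦ a + j r on positions, and images and preimages of progressions under an injective
-- affine map are again progressions. Hence the chains from ∅ to s are exactly the images of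
-- the chains of length k-1 in L_|s|, and sorting by i = |s| gives the recurrence. The only
-- chain of length 1 is ∅ ⊂ [n], and sizes grow strictly along a chain, so no chain is longer
-- than n.
module Submission where

open import Defs
open import Data.Bool as Bool using ()
open import Data.Empty using () renaming (⊥ to Empty)
open import Data.Fin as Fin using (Fin; toℕ; fromℕ<; inject₁; fromℕ) renaming (zero to fzero; suc to fsuc)
open import Data.Fin.Induction using (<-wellFounded)
open import Data.Fin.Permutation using (↔⇒≡)
open import Data.Fin.Properties using (toℕ-injective; toℕ-fromℕ<; toℕ<n; 0↔⊥; 1↔⊤; +↔⊎; *↔×)
open import Data.Fin.Subset using (Subset; inside; outside; _∈_; _⊆_; _⊂_; ∣_∣; ⊥; ⊤)
open import Data.Fin.Subset.Properties
  using (drop-∷-⊆; ∉⊥; ∈⊤; ⊆⊤; ⊆-trans; in⊂in; out⊂in; p⊂q⇒p⊆q; p⊂q⇒∣p∣<∣q∣;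
         ∣⊥∣≡0; ∣⊤∣≡n)
open import Data.Irrelevant as Irrelevant using (Irrelevant; [_])
open import Data.Nat using (ℕ; zero; suc; _+_; _*_; _∸_; _≤_; _<_; s≤s; z≤n; _≤?_; _≟_)
open import Data.Nat.Properties
open import Data.Nat.Tactic.RingSolver using (solve-∀)
open import Data.Product as Product using (Σ; ∃; ∃₂; _×_; _,_; proj₁; proj₂)
open import Data.Product.Function.Dependent.Propositional using (Σ-↔)
open import Data.Product.Function.NonDependent.Propositional using (_×-↔_)
open import Data.Sum using (_⊎_; inj₁; inj₂)
open import Data.Sum.Function.Propositional using (_⊎-↔_)
open import Data.Unit using (tt) renaming (⊤ to Unit)
open import Data.Vec using (Vec; []; _∷_; here; there; lookup; head; last; init; initLast; map; _∷ʳ_)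
open import Data.Vec.Properties using (≡-dec; init-∷ʳ; last-∷ʳ)
open import Data.Vec.Relation.Unary.All as All using (All; []; _∷_)
import Data.Vec.Relation.Unary.All.Properties as All
open import Data.Vec.Relation.Unary.Linked as Linked using (Linked; [-]; _∷_)
import Data.Vec.Relation.Unary.Linked.Properties as Linked
open import Function.Base using (_∘_; id)
open import Function.Bundles using (_⇔_; mk⇔; Equivalence; _↔_; mk↔ₛ′; Inverse)
open import Function.Properties.Inverse using (↔-refl; ↔-sym; ↔-trans)
open import Induction.WellFounded using (Acc; acc)
open import Relation.Binary.Definitions using (DecidableEquality)
open import Relation.Binary.PropositionalEquality
open import Relation.Nullary using (¬_; contradiction; recompute; yes; no)

private variable
  n : ℕ

Σ-Irrelevant-≡ : ∀ {A : Set} {P : A → Set} → DecidableEquality A →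
                 ∀ {x y} {p : Irrelevant (P x)} {q : Irrelevant (P y)} → .(x ≡ y) → (x , p) ≡ (y , q)
Σ-Irrelevant-≡ _≟_ {x} {y} x≡y with recompute (x ≟ y) x≡y
... | refl = refl

Σ-Irrelevant-cong : ∀ {A : Set} {P Q : A → Set} → (∀ {x} → P x ⇔ Q x) →
                    Σ A (Irrelevant ∘ P) ↔ Σ A (Irrelevant ∘ Q)
Σ-Irrelevant-cong P⇔Q =
  mk↔ₛ′ (Product.map₂ (Irrelevant.map (Equivalence.to P⇔Q)))
        (Product.map₂ (Irrelevant.map (Equivalence.from P⇔Q))) (λ _ → refl) (λ _ → refl)

Fin-empty : ∀ {m} {A : Set} → Fin m ↔ A → ¬ A → m ≡ 0
Fin-empty {zero}  _   _  = refl
Fin-empty {suc _} m↔A ¬A = contradiction (Inverse.to m↔A fzero) ¬A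

⨄ : ℕ → (ℕ → Set) → Set
⨄ zero    X = Empty
⨄ (suc m) X = ⨄ m X ⊎ X (suc m)

⨄↔Fin-sum : ∀ m {X : ℕ → Set} {f : ℕ → ℕ} →
            (∀ i → 1 ≤ i → i ≤ m → X i ↔ Fin (f i)) → ⨄ m X ↔ Fin (sum1to m f)
⨄↔Fin-sum zero    _  = ↔-sym 0↔⊥
⨄↔Fin-sum (suc m) X↔ =
  ↔-trans (⨄↔Fin-sum m (λ i i≥1 i≤m → X↔ i i≥1 (m≤n⇒m≤1+n i≤m)) ⊎-↔
           X↔ (suc m) (s≤s z≤n) ≤-refl)
          (↔-sym +↔⊎)

OfSize : {A : Set} → (A → ℕ) → ℕ → Set
OfSize {A} size i = Σ A λ x → size x ≡ i

module _ {A : Set} (size : A → ℕ) (T : ℕ → Set) where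

  private
    AtMost : ℕ → Set
    AtMost m = Σ A λ x → Irrelevant (size x ≤ m) × T (size x)

    AtMost-zero : ¬ T 0 → AtMost 0 ↔ Empty
    AtMost-zero ¬T0 = mk↔ₛ′ to (λ ()) (λ ()) (λ z → contradiction (to z) λ ())
      where
      to : AtMost 0 → Empty
      to (x , [ x≤0 ] , t) = ¬T0 (subst T (n≤0⇒n≡0 (recompute (size x ≤? 0) x≤0)) t)

    AtMost-suc : ∀ m → AtMost (suc m) ↔ (AtMost m ⊎ OfSize size (suc m) × T (suc m))
    AtMost-suc m = mk↔ₛ′ to from to∘from from∘to
      where
      to : AtMost (suc m) → AtMost m ⊎ OfSize size (suc m) × T (suc m)
      to (x , [ x≤ ] , t) with size x ≟ suc m
      ... | yes x≡ = inj₂ ((x , x≡) , subst T x≡ t)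
      ... | no  x≢ = inj₁ (x , [ ≤-pred (≤∧≢⇒< x≤ x≢) ] , t)
      from : AtMost m ⊎ OfSize size (suc m) × T (suc m) → AtMost (suc m)
      from (inj₁ (x , [ x≤ ] , t)) = x , [ m≤n⇒m≤1+n x≤ ] , t
      from (inj₂ ((x , x≡) , t))   = x , [ ≤-reflexive x≡ ] , subst T (sym x≡) t
      to∘from : ∀ y → to (from y) ≡ y
      to∘from (inj₁ (x , [ x≤ ] , t)) with size x ≟ suc m
      ... | yes x≡ = contradiction x≡ (<⇒≢ (s≤s (recompute (size x ≤? m) x≤)))
      ... | no  _  = refl
      to∘from (inj₂ ((x , x≡) , t)) with size x ≟ suc m
      ... | yes x≡′ rewrite ≡-irrelevant x≡′ x≡ =
        cong (λ t′ → inj₂ ((x , x≡) , t′)) (subst-subst-sym x≡)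
      ... | no  x≢  = contradiction x≡ x≢
      from∘to : ∀ z → from (to z) ≡ z
      from∘to (x , [ x≤ ] , t) with size x ≟ suc m
      ... | yes x≡ = cong (λ t′ → x , [ x≤ ] , t′) (subst-sym-subst x≡)
      ... | no  _  = refl

  Σ-by-size : ∀ m → ¬ T 0 → (∀ x → size x ≤ m) →
              Σ A (T ∘ size) ↔ ⨄ m (λ i → OfSize size i × T i)
  Σ-by-size m ¬T0 bounded = ↔-trans bound (split m)
    where
    add-bound : Σ A (T ∘ size) → AtMost m
    add-bound (x , t) = x , [ bounded x ] , t
    bound : Σ A (T ∘ size) ↔ AtMost m
    bound = mk↔ₛ′ add-bound (λ (x , _ , t) → x , t) (λ _ → refl) (λ _ → refl)
    split : ∀ m → AtMost m ↔ ⨄ m (λ i → OfSize size i × T i)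
    split zero    = AtMost-zero ¬T0
    split (suc m) = ↔-trans (AtMost-suc m) (split m ⊎-↔ ↔-refl)

module _ {A : Set} where

  lookup-fromℕ : ∀ k (v : Vec A (suc k)) → lookup v (fromℕ k) ≡ last v
  lookup-fromℕ zero    (_ ∷ [])    = refl
  lookup-fromℕ (suc k) (_ ∷ _ ∷ v) = lookup-fromℕ k (_ ∷ v)

  last-map : ∀ {B : Set} {k} (f : A → B) (v : Vec A (suc k)) → last (map f v) ≡ f (last v)
  last-map f (_ ∷ [])    = refl
  last-map f (_ ∷ _ ∷ v) = last-map f (_ ∷ v)

  head-init : ∀ {k} (v : Vec A (suc (suc k))) → head (init v) ≡ head v
  head-init (_ ∷ _ ∷ _) = refl

  init-∷ʳ-last : ∀ {k} (v : Vec A (suc k)) → init v ∷ʳ last v ≡ v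
  init-∷ʳ-last v = sym (proj₂ (proj₂ (initLast v)))

  All-last : ∀ {P : A → Set} {k} {v : Vec A (suc k)} → All P v → P (last v)
  All-last (px ∷ [])          = px
  All-last (_ ∷ pxs@(_ ∷ _)) = All-last pxs

  module _ {R : A → A → Set} where

    Linked⇒consecutive : ∀ {k} {v : Vec A (suc k)} → Linked R v →
                         ∀ i → R (lookup v (inject₁ i)) (lookup v (fsuc i))
    Linked⇒consecutive {v = _ ∷ _ ∷ _} (r ∷ _)  fzero    = r
    Linked⇒consecutive {v = _ ∷ _ ∷ _} (_ ∷ rs) (fsuc i) = Linked⇒consecutive rs i

    consecutive⇒Linked : ∀ {k} {v : Vec A (suc k)} →
                         (∀ i → R (lookup v (inject₁ i)) (lookup v (fsuc i))) → Linked R v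
    consecutive⇒Linked {v = _ ∷ []}    _  = [-]
    consecutive⇒Linked {v = _ ∷ _ ∷ _} rs = rs fzero ∷ consecutive⇒Linked (rs ∘ fsuc)

-- Increasing enumerations

module _ {m k : ℕ} (h : Fin m → ℕ) (g : ℕ → ℕ)
  (h-< : ∀ {x y} → x Fin.< y → h x < h y)
  (g-< : ∀ {i j} → i < j → g i < g j)
  (h⊆g : ∀ y → ∃ λ j → j < k × h y ≡ g j)
  (g⊆h : ∀ j → j < k → ∃ λ y → g j ≡ h y) where

  private
    h-≤ : ∀ {x y} → x Fin.≤ y → h x ≤ h y
    h-≤ x≤y with m≤n⇒m<n∨m≡n x≤y
    ... | inj₁ x<y = <⇒≤ (h-< x<y)
    ... | inj₂ x≡y = ≤-reflexive (cong h (toℕ-injective x≡y))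

    g-≤ : ∀ {i j} → i ≤ j → g i ≤ g j
    g-≤ i≤j with m≤n⇒m<n∨m≡n i≤j
    ... | inj₁ i<j = <⇒≤ (g-< i<j)
    ... | inj₂ refl = ≤-refl

    AgreeBelow : Fin m → Set
    AgreeBelow y = ∀ {y₀} → y₀ Fin.< y → h y₀ ≡ g (toℕ y₀)

    index-≤ : ∀ y → AgreeBelow y → ∀ {t} → h y ≡ g t → toℕ y ≤ t
    index-≤ y agree hy≡gt = ≮⇒≥ λ t<y →
      let t<m = <-trans t<y (toℕ<n y)
          y₀<y = subst (_< toℕ y) (sym (toℕ-fromℕ< t<m)) t<y
      in <-irrefl (trans (agree y₀<y) (trans (cong g (toℕ-fromℕ< t<m)) (sym hy≡gt))) (h-< y₀<y)

    ≤-index : ∀ y → AgreeBelow y → ∀ {y′} → g (toℕ y) ≡ h y′ → y Fin.≤ y′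
    ≤-index y agree gy≡hy′ =
      ≮⇒≥ λ y′<y → <-irrefl (sym (trans gy≡hy′ (agree y′<y))) (g-< y′<y)

    agree-at : ∀ y → Acc Fin._<_ y → h y ≡ g (toℕ y)
    agree-at y (acc below) =
      let t , t<k , hy≡gt = h⊆g y
          y≤t = index-≤ y agree hy≡gt
          y′ , gy≡hy′ = g⊆h (toℕ y) (≤-<-trans y≤t t<k)
      in ≤-antisym (subst (_ ≤_) (sym gy≡hy′) (h-≤ (≤-index y agree gy≡hy′)))
                   (subst (_ ≤_) (sym hy≡gt) (g-≤ y≤t))
      where
      agree : AgreeBelow y
      agree y₀<y = agree-at _ (below y₀<y)

  enumerations-agree : ∀ y → h y ≡ g (toℕ y)
  enumerations-agree y = agree-at y (<-wellFounded y)

-- Progressions and affine maps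

Progression : (ℕ → Set) → ℕ → ℕ → ℕ → Set
Progression P a r k = ∀ m → P m ⇔ ∃ λ j → j < k × m ≡ a + j * r

progression-∘suc : ∀ {P : ℕ → Set} {a r k} → Progression P (suc a) r k → Progression (P ∘ suc) a r k
progression-∘suc prog m = mk⇔
  (λ pm → let j , j<k , eq = Equivalence.to (prog (suc m)) pm in j , j<k , suc-injective eq)
  (λ { (j , j<k , eq) → Equivalence.from (prog (suc m)) (j , j<k , cong suc eq) })

progression-from-∘suc : ∀ {P : ℕ → Set} {a r k} → ¬ P 0 →
                        Progression (P ∘ suc) a r k → Progression P (suc a) r k
progression-from-∘suc ¬P0 prog zero    = mk⇔ (λ P0 → contradiction P0 ¬P0) (λ { (_ , _ , ()) })
progression-from-∘suc ¬P0 prog (suc m) = mk⇔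
  (λ pm → let j , j<k , eq = Equivalence.to (prog m) pm in j , j<k , cong suc eq)
  (λ { (j , j<k , eq) → Equivalence.from (prog m) (j , j<k , suc-injective eq) })

affine-< : ∀ c {d i j} → 1 ≤ d → i < j → c + i * d < c + j * d
affine-< c {d} (s≤s z≤n) i<j = +-monoʳ-< c (*-monoˡ-< d i<j)

affine-<⁻ : ∀ c {d i j} → c + i * d < c + j * d → i < j
affine-<⁻ c {d} {i} {j} lt = *-cancelʳ-< d i j (+-cancelˡ-< c _ _ lt)

affine-injective : ∀ c {d i j} → 1 ≤ d → c + i * d ≡ c + j * d → i ≡ j
affine-injective c {d} {i} {j} (s≤s z≤n) eq = *-cancelʳ-≡ i j d (+-cancelˡ-≡ c _ _ eq)

affine-∘ : ∀ c d a r j → c + (a + j * r) * d ≡ (c + a * d) + j * (r * d)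
affine-∘ = solve-∀

module AffineImage {P Q : ℕ → Set} {c d : ℕ} (d≥1 : 1 ≤ d)
                   (Q⇔P : ∀ m → Q m ⇔ ∃ λ j → P j × m ≡ c + j * d) where

  progression-image : ∀ {a r k} → Progression P a r k → Progression Q (c + a * d) (r * d) k
  progression-image {a} {r} {k} prog m = mk⇔ to from
    where
    to : Q m → ∃ λ j → j < k × m ≡ c + a * d + j * (r * d)
    to qm with Equivalence.to (Q⇔P m) qm
    ... | i , pi , refl with Equivalence.to (prog i) pi
    ... | j , j<k , refl = j , j<k , affine-∘ c d a r j
    from : (∃ λ j → j < k × m ≡ c + a * d + j * (r * d)) → Q m
    from (j , j<k , refl) = Equivalence.from (Q⇔P _)
      (a + j * r , Equivalence.from (prog _) (j , j<k , refl) , sym (affine-∘ c d a r j))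

  in-range : ∀ {m} → Q m → ∃ λ i → m ≡ c + i * d
  in-range qm = let i , _ , eq = Equivalence.to (Q⇔P _) qm in i , eq

  Q-at : ∀ j → Q (c + j * d) ⇔ P j
  Q-at j = mk⇔
    (λ q → let i , pi , eq = Equivalence.to (Q⇔P _) q in subst P (sym (affine-injective c d≥1 eq)) pi)
    (λ pj → Equivalence.from (Q⇔P _) (j , pj , refl))

  pullback : ∀ {A R K x e} → Progression Q A R K → (∀ j → j < K → A + j * R ≡ c + (x + j * e) * d) →
             Progression P x e K
  pullback progQ coincide m = mk⇔
    (λ pm → let j , j<K , eq = Equivalence.to (progQ _) (Equivalence.from (Q-at m) pm)
            in j , j<K , affine-injective c d≥1 (trans eq (coincide j j<K)))
    (λ { (j , j<K , refl) →
         Equivalence.to (Q-at _) (subst Q (coincide j j<K) (Equivalence.from (progQ _) (j , j<K , refl))) })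

  first-term : ∀ {A R K} → Progression Q A R (suc K) → ∃ λ x → A ≡ c + x * d
  first-term {A} progQ = in-range (Equivalence.from (progQ A) (0 , s≤s z≤n , sym (+-identityʳ A)))

  second-term : ∀ {A R K} → Progression Q A R (suc (suc K)) → ∃ λ y → A + R ≡ c + y * d
  second-term {A} {R} progQ =
    in-range (Equivalence.from (progQ (A + R)) (1 , s≤s (s≤s z≤n) , cong (A +_) (sym (*-identityˡ R))))

  -- The first two terms A = c + x d and A + R = c + y d of Q fix the progression x, x + (y - x), … of P.
  progression-preimage : ∀ {A R K} → 1 ≤ R → Progression Q A R K →
                         ∃₂ λ x e → 1 ≤ e × Progression P x e K
  progression-preimage {K = zero} _ progQ = 0 , 1 , ≤-refl , pullback progQ λ _ ()
  progression-preimage {A} {K = suc zero} _ progQ with first-term progQ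
  ... | x , A≡ = x , 1 , ≤-refl , pullback progQ λ
    { zero _ → trans (+-identityʳ A) (trans A≡ (cong (λ z → c + z * d) (sym (+-identityʳ x))))
    ; (suc _) (s≤s ()) }
  progression-preimage {A} {R} {suc (suc K)} R≥1 progQ with first-term progQ | second-term progQ
  ... | x , A≡ | y , A+R≡ = x , y ∸ x , m<n⇒0<n∸m x<y , pullback progQ coincide
    where
    open ≡-Reasoning
    x<y : x < y
    x<y = affine-<⁻ c (subst₂ _<_ A≡ A+R≡ (m<m+n A R≥1))
    R≡ : R ≡ (y ∸ x) * d
    R≡ = +-cancelˡ-≡ A R ((y ∸ x) * d) (begin
      A + R                     ≡⟨ A+R≡ ⟩
      c + y * d                 ≡⟨ cong (λ z → c + z * d) (sym (m+[n∸m]≡n (<⇒≤ x<y))) ⟩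
      c + (x + (y ∸ x)) * d     ≡⟨ cong (c +_) (*-distribʳ-+ d x (y ∸ x)) ⟩
      c + (x * d + (y ∸ x) * d) ≡⟨ sym (+-assoc c (x * d) ((y ∸ x) * d)) ⟩
      c + x * d + (y ∸ x) * d   ≡⟨ cong (_+ (y ∸ x) * d) (sym A≡) ⟩
      A + (y ∸ x) * d           ∎)
    coincide : ∀ j → j < suc (suc K) → A + j * R ≡ c + (x + j * (y ∸ x)) * d
    coincide j _ = begin
      A + j * R                     ≡⟨ cong₂ (λ a r → a + j * r) A≡ R≡ ⟩
      c + x * d + j * ((y ∸ x) * d) ≡⟨ sym (affine-∘ c d x (y ∸ x) j) ⟩
      c + (x + j * (y ∸ x)) * d     ∎

-- Enumerating a subset of [n]

enum : (s : Subset n) → Fin ∣ s ∣ → Fin n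
enum (inside ∷ s)  fzero    = fzero
enum (inside ∷ s)  (fsuc y) = fsuc (enum s y)
enum (outside ∷ s) y        = fsuc (enum s y)

image : (s : Subset n) → Subset ∣ s ∣ → Subset n
image []            []      = []
image (inside ∷ s)  (b ∷ u) = b ∷ image s u
image (outside ∷ s) u       = outside ∷ image s u

preimage : (s : Subset n) → Subset n → Subset ∣ s ∣
preimage []            []      = []
preimage (inside ∷ s)  (b ∷ t) = b ∷ preimage s t
preimage (outside ∷ s) (_ ∷ t) = preimage s t

enum-< : ∀ (s : Subset n) {y y′} → y Fin.< y′ → enum s y Fin.< enum s y′
enum-< (inside ∷ s)  {fzero}  {fsuc _} _        = s≤s z≤n
enum-< (inside ∷ s)  {fsuc _} {fsuc _} (s≤s lt) = s≤s (enum-< s lt)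
enum-< (outside ∷ s) lt                         = s≤s (enum-< s lt)

enum-∈ : ∀ (s : Subset n) y → enum s y ∈ s
enum-∈ (inside ∷ s)  fzero    = here
enum-∈ (inside ∷ s)  (fsuc y) = there (enum-∈ s y)
enum-∈ (outside ∷ s) y        = there (enum-∈ s y)

enum-onto : ∀ (s : Subset n) {x} → x ∈ s → ∃ λ y → enum s y ≡ x
enum-onto (inside ∷ s)  here        = fzero , refl
enum-onto (inside ∷ s)  (there x∈s) with enum-onto s x∈s
... | y , refl = fsuc y , refl
enum-onto (outside ∷ s) (there x∈s) with enum-onto s x∈s
... | y , refl = y , refl

image-⊆ : ∀ (s : Subset n) u → image s u ⊆ s
image-⊆ (inside ∷ s)  (b ∷ u) here       = here
image-⊆ (inside ∷ s)  (b ∷ u) (there x∈) = there (image-⊆ s u x∈)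
image-⊆ (outside ∷ s) u       (there x∈) = there (image-⊆ s u x∈)

∈-image⁺ : ∀ (s : Subset n) u {y} → y ∈ u → enum s y ∈ image s u
∈-image⁺ (inside ∷ s)  (b ∷ u) here       = here
∈-image⁺ (inside ∷ s)  (b ∷ u) (there y∈) = there (∈-image⁺ s u y∈)
∈-image⁺ (outside ∷ s) u       y∈         = there (∈-image⁺ s u y∈)

∈-image⁻ : ∀ (s : Subset n) u {y} → enum s y ∈ image s u → y ∈ u
∈-image⁻ (inside ∷ s)  (b ∷ u) {fzero}  here       = here
∈-image⁻ (inside ∷ s)  (b ∷ u) {fsuc y} (there y∈) = there (∈-image⁻ s u y∈)
∈-image⁻ (outside ∷ s) u                (there y∈) = ∈-image⁻ s u y∈

preimage-image : ∀ (s : Subset n) u → preimage s (image s u) ≡ u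
preimage-image []            []      = refl
preimage-image (inside ∷ s)  (b ∷ u) = cong (b ∷_) (preimage-image s u)
preimage-image (outside ∷ s) u       = preimage-image s u

image-preimage : ∀ (s : Subset n) {t} → t ⊆ s → image s (preimage s t) ≡ t
image-preimage []            {[]}          _   = refl
image-preimage (inside ∷ s)  {b ∷ t}       t⊆s = cong (b ∷_) (image-preimage s (drop-∷-⊆ t⊆s))
image-preimage (outside ∷ s) {outside ∷ t} t⊆s = cong (outside ∷_) (image-preimage s (drop-∷-⊆ t⊆s))
image-preimage (outside ∷ s) {inside ∷ t}  t⊆s with t⊆s here
... | ()

image-⊤ : ∀ (s : Subset n) → image s ⊤ ≡ s
image-⊤ []            = refl
image-⊤ (inside ∷ s)  = cong (inside ∷_) (image-⊤ s)
image-⊤ (outside ∷ s) = cong (outside ∷_) (image-⊤ s)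

image-⊥ : ∀ (s : Subset n) → image s ⊥ ≡ ⊥
image-⊥ []            = refl
image-⊥ (inside ∷ s)  = cong (outside ∷_) (image-⊥ s)
image-⊥ (outside ∷ s) = cong (outside ∷_) (image-⊥ s)

preimage-⊤ : ∀ (s : Subset n) → preimage s s ≡ ⊤
preimage-⊤ s = trans (cong (preimage s) (sym (image-⊤ s))) (preimage-image s ⊤)

preimage-⊥ : ∀ (s : Subset n) → preimage s ⊥ ≡ ⊥
preimage-⊥ s = trans (cong (preimage s) (sym (image-⊥ s))) (preimage-image s ⊥)

module _ (s : Subset n) {u v : Subset ∣ s ∣} where

  image-⊆⁺ : u ⊆ v → image s u ⊆ image s v
  image-⊆⁺ u⊆v x∈ with enum-onto s (image-⊆ s u x∈)
  ... | _ , refl = ∈-image⁺ s v (u⊆v (∈-image⁻ s u x∈))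

  image-⊆⁻ : image s u ⊆ image s v → u ⊆ v
  image-⊆⁻ su⊆sv y∈ = ∈-image⁻ s v (su⊆sv (∈-image⁺ s u y∈))

  image-⊂⁺ : u ⊂ v → image s u ⊂ image s v
  image-⊂⁺ (u⊆v , y , y∈v , y∉u) =
    image-⊆⁺ u⊆v , enum s y , ∈-image⁺ s v y∈v , y∉u ∘ ∈-image⁻ s u

  image-⊂⁻ : image s u ⊂ image s v → u ⊂ v
  image-⊂⁻ (su⊆sv , x , x∈sv , x∉su) with enum-onto s (image-⊆ s v x∈sv)
  ... | y , refl = image-⊆⁻ su⊆sv , y , ∈-image⁻ s v x∈sv , x∉su ∘ ∈-image⁺ s u

enum-progression : ∀ (s : Subset n) {a r k} → 1 ≤ r → Progression (_∈ℕ s) a r k →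
                   ∀ y → suc (toℕ (enum s y)) ≡ a + toℕ y * r
enum-progression s {a} {r} {k} r≥1 prog =
  enumerations-agree (λ y → suc (toℕ (enum s y))) (λ j → a + j * r)
    (λ y<y′ → s≤s (enum-< s y<y′)) (affine-< a r≥1) enum⊆prog prog⊆enum
  where
  enum⊆prog : ∀ y → ∃ λ j → j < k × suc (toℕ (enum s y)) ≡ a + j * r
  enum⊆prog y = Equivalence.to (prog _) (enum s y , refl , enum-∈ s y)
  prog⊆enum : ∀ j → j < k → ∃ λ y → a + j * r ≡ suc (toℕ (enum s y))
  prog⊆enum j j<k with Equivalence.from (prog _) (j , j<k , refl)
  ... | x , x≡ , x∈s with enum-onto s x∈s
  ... | y , refl = y , sym x≡

-- Positions j in u are counted from 0 (suc j ∈ℕ u), so enum s acts on them as j ↦ a + j r.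
∈ℕ-image : ∀ (s : Subset n) {a r} → (∀ y → suc (toℕ (enum s y)) ≡ a + toℕ y * r) →
           ∀ u m → m ∈ℕ image s u ⇔ ∃ λ j → suc j ∈ℕ u × m ≡ a + j * r
∈ℕ-image s {a} {r} enum≡ u m = mk⇔ to from
  where
  to : ∀ {m} → m ∈ℕ image s u → ∃ λ j → suc j ∈ℕ u × m ≡ a + j * r
  to (x , refl , x∈) with enum-onto s (image-⊆ s u x∈)
  ... | y , refl = toℕ y , (y , refl , ∈-image⁻ s u x∈) , enum≡ y
  from : ∀ {m} → (∃ λ j → suc j ∈ℕ u × m ≡ a + j * r) → m ∈ℕ image s u
  from (_ , (y , refl , y∈u) , refl) = enum s y , enum≡ y , ∈-image⁺ s u y∈u

IsAP-image : ∀ {s : Subset n} {u} → IsAP s → IsAP u → IsAP (image s u)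
IsAP-image {s = s} {u} (a , r , _ , a≥1 , r≥1 , prog) (suc a′ , r′ , k′ , _ , r′≥1 , progᵤ) =
  a + a′ * r , r′ * r , k′ , ≤-trans a≥1 (m≤m+n a _) , *-mono-≤ r′≥1 r≥1 ,
  AffineImage.progression-image r≥1 (∈ℕ-image s (enum-progression s r≥1 prog) u) (progression-∘suc progᵤ)

IsAP-of-image : ∀ {s : Subset n} {u} → IsAP s → IsAP (image s u) → IsAP u
IsAP-of-image {s = s} {u} (_ , r , _ , _ , r≥1 , prog) (_ , R , K , _ , R≥1 , progₛᵤ)
  with AffineImage.progression-preimage r≥1 (∈ℕ-image s (enum-progression s r≥1 prog) u) R≥1 progₛᵤ
... | x , e , e≥1 , progᵤ =
  suc x , e , K , s≤s z≤n , e≥1 , progression-from-∘suc (λ { (_ , () , _) }) progᵤ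

IsAP-⊥ : IsAP (⊥ {n})
IsAP-⊥ = 1 , 1 , 0 , s≤s z≤n , s≤s z≤n , λ _ →
  mk⇔ (λ { (_ , _ , x∈⊥) → contradiction x∈⊥ ∉⊥ }) λ ()

IsAP-⊤ : IsAP (⊤ {n})
IsAP-⊤ {n} = 1 , 1 , n , s≤s z≤n , s≤s z≤n , λ _ → mk⇔ to from
  where
  to : ∀ {m} → m ∈ℕ ⊤ → ∃ λ j → j < n × m ≡ 1 + j * 1
  to (x , x≡m , _) = toℕ x , toℕ<n x , trans (sym x≡m) (cong suc (sym (*-identityʳ (toℕ x))))
  from : ∀ {m} → (∃ λ j → j < n × m ≡ 1 + j * 1) → m ∈ℕ ⊤
  from (j , j<n , refl) = fromℕ< j<n , cong suc (trans (toℕ-fromℕ< j<n) (sym (*-identityʳ j))) , ∈⊤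

∣p∣<n⇒p⊂⊤ : ∀ (s : Subset n) → ∣ s ∣ < n → s ⊂ ⊤
∣p∣<n⇒p⊂⊤ (inside ∷ s)  (s≤s lt) = in⊂in (∣p∣<n⇒p⊂⊤ s lt)
∣p∣<n⇒p⊂⊤ (outside ∷ s) _        = out⊂in ⊆⊤

⊥⊂⊤ : ⊥ ⊂ ⊤ {suc n}
⊥⊂⊤ {n} = ∣p∣<n⇒p⊂⊤ ⊥ (subst (_< suc n) (sym (∣⊥∣≡0 (suc n))) (s≤s z≤n))

ProperAP : ℕ → Set
ProperAP n = Σ (Subset n) λ s → Irrelevant (IsAP s × s ⊂ ⊤)

∣_∣ₚ : ProperAP n → ℕ
∣ s ∣ₚ = ∣ proj₁ s ∣

ProperAP-of-size : ∀ {n i} → i < n → OfSize ∣_∣ₚ i ↔ APofSize n i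
ProperAP-of-size {n} {i} i<n = mk↔ₛ′ to from (λ _ → refl) from∘to
  where
  to : OfSize ∣_∣ₚ i → APofSize n i
  to ((s , [ p ]) , ∣s∣≡i) = s , [ proj₁ p , ∣s∣≡i ]
  from : APofSize n i → OfSize ∣_∣ₚ i
  from (s , [ p ]) =
    (s , [ proj₁ p , ∣p∣<n⇒p⊂⊤ s (subst (_< n) (sym (proj₂ p)) i<n) ]) , recompute (∣ s ∣ ≟ i) (proj₂ p)
  from∘to : ∀ x → from (to x) ≡ x
  from∘to (s , ∣s∣≡i) = cong (s ,_) (≡-irrelevant _ ∣s∣≡i)

-- Chains of progressions

APChain : ∀ {m} → Vec (Subset n) m → Set
APChain v = All IsAP v × Linked _⊂_ v

IsChainTo : ∀ {k} → Subset n → Vec (Subset n) (suc k) → Set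
IsChainTo s v = APChain v × head v ≡ ⊥ × last v ≡ s

ChainTo : Subset n → ℕ → Set
ChainTo {n} s k = Σ (Vec (Subset n) (suc k)) (Irrelevant ∘ IsChainTo s)

_≟ᵥ_ : ∀ {m} → DecidableEquality (Vec (Subset n) m)
_≟ᵥ_ = ≡-dec (≡-dec Bool._≟_)

Chain↔ChainTo : ∀ {n k} → Chain n k ↔ ChainTo ⊤ k
Chain↔ChainTo {n} {k} = Σ-Irrelevant-cong (mk⇔ to from)
  where
  to : ∀ {v} → IsChainEmptyFull n k v → IsChainTo ⊤ v
  to {_ ∷ _} (aps , ⊂s , h , l) =
    (All.lookup⁻ aps , consecutive⇒Linked ⊂s) , h , trans (sym (lookup-fromℕ k _)) l
  from : ∀ {v} → IsChainTo ⊤ v → IsChainEmptyFull n k v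
  from {_ ∷ _} ((aps , ls) , h , l) = All.lookup⁺ aps , Linked⇒consecutive ls , h , trans (lookup-fromℕ k _) l

⊂-chain⇒⊆-last : ∀ {k} {v : Vec (Subset n) (suc k)} → Linked _⊂_ v → All (_⊆ last v) v
⊂-chain⇒⊆-last {v = _ ∷ []}    [-]        = id ∷ []
⊂-chain⇒⊆-last {v = _ ∷ _ ∷ _} (x⊂y ∷ ls) =
  let rest = ⊂-chain⇒⊆-last ls in ⊆-trans (p⊂q⇒p⊆q x⊂y) (All.head rest) ∷ rest

chain⊆top : ∀ {s : Subset n} {k} {v : Vec (Subset n) (suc k)} → IsChainTo s v → All (_⊆ s) v
chain⊆top {v = v} ((_ , ls) , _ , l) = subst (λ t → All (_⊆ t) v) l (⊂-chain⇒⊆-last ls)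

⊂-chain-size : ∀ {k} {v : Vec (Subset n) (suc k)} → Linked _⊂_ v → ∣ head v ∣ + k ≤ ∣ last v ∣
⊂-chain-size {v = x ∷ []}                [-]        = ≤-reflexive (+-identityʳ ∣ x ∣)
⊂-chain-size {k = suc k} {v = x ∷ y ∷ v} (x⊂y ∷ ls) = begin
  ∣ x ∣ + suc k    ≡⟨ +-suc ∣ x ∣ k ⟩
  suc ∣ x ∣ + k    ≤⟨ +-monoˡ-≤ k (p⊂q⇒∣p∣<∣q∣ x⊂y) ⟩
  ∣ y ∣ + k        ≤⟨ ⊂-chain-size ls ⟩
  ∣ last (y ∷ v) ∣ ∎
  where open ≤-Reasoning

ChainTo⊤-length : ∀ {n k} → ChainTo (⊤ {n}) k → k ≤ n
ChainTo⊤-length {n} {k} (_ , [ c ]) = recompute (k ≤? n)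
  (subst₂ (λ a b → a + k ≤ b) (trans (cong ∣_∣ (proj₁ (proj₂ c))) (∣⊥∣≡0 n))
                             (trans (cong ∣_∣ (proj₂ (proj₂ c))) (∣⊤∣≡n n))
                             (⊂-chain-size (proj₂ (proj₁ c))))

Chain-length : ∀ {n k} → Chain n k → k ≤ n
Chain-length = ChainTo⊤-length ∘ Inverse.to Chain↔ChainTo

Chain-one : Chain (suc n) 1 ↔ Fin 1
Chain-one =
  ↔-trans Chain↔ChainTo (↔-trans (mk↔ₛ′ (λ _ → tt) (λ _ → ⊥∷⊤) (λ _ → refl) unique) (↔-sym 1↔⊤))
  where
  ⊥∷⊤ : ChainTo ⊤ 1
  ⊥∷⊤ = ⊥ ∷ ⊤ ∷ [] , [ (IsAP-⊥ ∷ IsAP-⊤ ∷ [] , ⊥⊂⊤ ∷ [-]) , refl , refl ]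
  unique : ∀ c → ⊥∷⊤ ≡ c
  unique (_ ∷ _ ∷ [] , [ c ]) =
    Σ-Irrelevant-≡ _≟ᵥ_
      (cong₂ (λ x y → x ∷ y ∷ []) (sym (proj₁ (proj₂ c))) (sym (proj₂ (proj₂ c))))

APChain-∷ʳ : ∀ {k} {w : Vec (Subset n) (suc k)} {t} →
             APChain w → last w ⊂ t → IsAP t → APChain (w ∷ʳ t)
APChain-∷ʳ {w = _ ∷ []}    (px ∷ [] , [-])       lw⊂t pt = px ∷ pt ∷ [] , lw⊂t ∷ [-]
APChain-∷ʳ {w = _ ∷ _ ∷ _} (px ∷ pxs , x⊂y ∷ ls) lw⊂t pt =
  let pxs′ , ls′ = APChain-∷ʳ (pxs , ls) lw⊂t pt in px ∷ pxs′ , x⊂y ∷ ls′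

APChain-init : ∀ {k} {v : Vec (Subset n) (suc (suc k))} →
               APChain v → APChain (init v) × last (init v) ⊂ last v
APChain-init {v = _ ∷ _ ∷ []}    (px ∷ _ , x⊂y ∷ _)    = (px ∷ [] , [-]) , x⊂y
APChain-init {v = _ ∷ _ ∷ _ ∷ _} (px ∷ pxs , x⊂y ∷ ls) =
  let (pxs′ , ls′) , l⊂l = APChain-init (pxs , ls) in (px ∷ pxs′ , x⊂y ∷ ls′) , l⊂l

ChainToProperAP : ℕ → ℕ → Set
ChainToProperAP n k = Σ (ProperAP n) λ s → ChainTo (proj₁ s) k

module _ {k : ℕ} where

  penultimate-proper : ∀ {v : Vec (Subset n) (suc (suc k))} → IsChainTo ⊤ v →
                       IsAP (last (init v)) × last (init v) ⊂ ⊤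
  penultimate-proper {v = v} (c , _ , l) =
    let (aps , _) , l⊂l = APChain-init c in All-last aps , subst (last (init v) ⊂_) l l⊂l

  drop-top-≡ : ∀ {s} {w w′ : Vec (Subset n) (suc k)} {p q p′ q′} → w′ ≡ w → last w ≡ s →
               _≡_ {A = ChainToProperAP n k} ((last w′ , p) , (w′ , q)) ((s , p′) , (w , q′))
  drop-top-≡ refl refl = refl

  ChainTo-drop-top : ChainTo (⊤ {n}) (suc k) ↔ ChainToProperAP n k
  ChainTo-drop-top {n} = mk↔ₛ′ to from to∘from from∘to
    where
    to : ChainTo ⊤ (suc k) → ChainToProperAP n k
    to (v , [ c ]) =
      (last (init v) , [ penultimate-proper c ]) ,
      (init v , [ proj₁ (APChain-init (proj₁ c)) , trans (head-init v) (proj₁ (proj₂ c)) , refl ])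
    from : ChainToProperAP n k → ChainTo ⊤ (suc k)
    from ((s , [ p ]) , (w@(_ ∷ _) , [ c ])) =
      w ∷ʳ ⊤ , [ APChain-∷ʳ (proj₁ c) (subst (_⊂ ⊤) (sym (proj₂ (proj₂ c))) (proj₂ p)) IsAP-⊤ ,
                 proj₁ (proj₂ c) , last-∷ʳ ⊤ w ]
    to∘from : ∀ c → to (from c) ≡ c
    to∘from ((s , _) , (w@(_ ∷ _) , [ c ])) =
      drop-top-≡ {w′ = init (w ∷ʳ ⊤)} (init-∷ʳ ⊤ w)
                 (recompute (≡-dec Bool._≟_ (last w) s) (proj₂ (proj₂ c)))
    from∘to : ∀ c → from (to c) ≡ c
    from∘to (v@(_ ∷ _ ∷ _) , [ c ]) =
      Σ-Irrelevant-≡ _≟ᵥ_ (trans (cong (init v ∷ʳ_) (sym (proj₂ (proj₂ c)))) (init-∷ʳ-last v))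

map-preimage-image : ∀ (s : Subset n) {m} (u : Vec (Subset ∣ s ∣) m) →
                     map (preimage s) (map (image s) u) ≡ u
map-preimage-image s []      = refl
map-preimage-image s (x ∷ u) = cong₂ _∷_ (preimage-image s x) (map-preimage-image s u)

map-image-preimage : ∀ (s : Subset n) {m} {w : Vec (Subset n) m} → All (_⊆ s) w →
                     map (image s) (map (preimage s) w) ≡ w
map-image-preimage s []          = refl
map-image-preimage s (x⊆s ∷ w⊆s) = cong₂ _∷_ (image-preimage s x⊆s) (map-image-preimage s w⊆s)

module _ (s : Subset n) (ap : IsAP s) where

  APChain-image⁺ : ∀ {m} {u : Vec (Subset ∣ s ∣) m} → APChain u → APChain (map (image s) u)
  APChain-image⁺ (aps , ls) =
    All.map⁺ (All.map (IsAP-image ap) aps) , Linked.map⁺ (Linked.map (image-⊂⁺ s) ls)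

  APChain-image⁻ : ∀ {m} {u : Vec (Subset ∣ s ∣) m} → APChain (map (image s) u) → APChain u
  APChain-image⁻ (aps , ls) =
    All.map (IsAP-of-image ap) (All.map⁻ aps) , Linked.map (image-⊂⁻ s) (Linked.map⁻ ls)

  image-chain : ∀ {k} {u : Vec (Subset ∣ s ∣) (suc k)} → IsChainTo ⊤ u → IsChainTo s (map (image s) u)
  image-chain {u = x ∷ u} (c , h , l) =
    APChain-image⁺ c ,
    trans (cong (image s) h) (image-⊥ s) ,
    trans (last-map (image s) (x ∷ u)) (trans (cong (image s) l) (image-⊤ s))

  preimage-chain : ∀ {k} {w : Vec (Subset n) (suc k)} → IsChainTo s w → IsChainTo ⊤ (map (preimage s) w)
  preimage-chain {w = x ∷ w} (c , h , l) =
    APChain-image⁻ (subst APChain (sym (map-image-preimage s (chain⊆top (c , h , l)))) c) ,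
    trans (cong (preimage s) h) (preimage-⊥ s) ,
    trans (last-map (preimage s) (x ∷ w)) (trans (cong (preimage s) l) (preimage-⊤ s))

ChainTo-image : ∀ (s : Subset n) {k} → .(IsAP s) → ChainTo (⊤ {∣ s ∣}) k ↔ ChainTo s k
ChainTo-image s {k} ap = mk↔ₛ′ to from to∘from from∘to
  where
  to : ChainTo ⊤ k → ChainTo s k
  to (u , [ c ]) = map (image s) u , [ image-chain s ap c ]
  from : ChainTo s k → ChainTo ⊤ k
  from (w , [ c ]) = map (preimage s) w , [ preimage-chain s ap c ]
  to∘from : ∀ c → to (from c) ≡ c
  to∘from (w , [ c ]) = Σ-Irrelevant-≡ _≟ᵥ_ (map-image-preimage s (chain⊆top c))
  from∘to : ∀ c → from (to c) ≡ c
  from∘to (u , _) = Σ-Irrelevant-≡ _≟ᵥ_ (map-preimage-image s u)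

Chain-drop-top : ∀ {n k} → Chain n (suc k) ↔ Σ (ProperAP n) λ s → Chain ∣ s ∣ₚ k
Chain-drop-top =
  ↔-trans Chain↔ChainTo
 (↔-trans ChainTo-drop-top
          (Σ-↔ ↔-refl λ { {s , [ p ]} →
            ↔-trans (↔-sym (ChainTo-image s (proj₁ p))) (↔-sym Chain↔ChainTo) }))

Chain-by-penultimate : ∀ {n k} → 1 ≤ k →
                       Chain (suc n) (suc k) ↔ ⨄ n (λ i → OfSize ∣_∣ₚ i × Chain i k)
Chain-by-penultimate {n} {k} k≥1 =
  ↔-trans Chain-drop-top (Σ-by-size ∣_∣ₚ (λ i → Chain i k) n no-chain-in-L₀ proper-size)
  where
  no-chain-in-L₀ : ¬ Chain 0 k
  no-chain-in-L₀ c = <⇒≱ k≥1 (Chain-length c)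
  proper-size : (s : ProperAP (suc n)) → ∣ s ∣ₚ ≤ n
  proper-size (s , [ p ]) = recompute (∣ s ∣ ≤? n)
    (≤-pred (subst (∣ s ∣ <_) (∣⊤∣≡n (suc n)) (p⊂q⇒∣p∣<∣q∣ (proj₂ p))))

lemma4 : (b p : ℕ → ℕ → ℕ)
    → (∀ n k → 1 ≤ n → 1 ≤ k → Fin (b n k) ↔ Chain n k)
    → (∀ n i → 1 ≤ n → Fin (p n i) ↔ APofSize n i)
    → (∀ n → 1 ≤ n → b n 1 ≡ 1)
      × (∀ n k → 1 ≤ n → 1 ≤ k → n < k → b n k ≡ 0)
      × (∀ n k → 2 ≤ k → k ≤ n → b n k ≡ sum1to (n ∸ 1) (λ i → p n i * b i (k ∸ 1)))
lemma4 b p b↔ p↔ = single-step , too-long , recurrence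
  where
  single-step : ∀ n → 1 ≤ n → b n 1 ≡ 1
  single-step (suc n) n≥1 = ↔⇒≡ (↔-trans (b↔ (suc n) 1 n≥1 ≤-refl) Chain-one)
  too-long : ∀ n k → 1 ≤ n → 1 ≤ k → n < k → b n k ≡ 0
  too-long n k n≥1 k≥1 n<k = Fin-empty (b↔ n k n≥1 k≥1) (λ c → <⇒≱ n<k (Chain-length c))
  recurrence : ∀ n k → 2 ≤ k → k ≤ n → b n k ≡ sum1to (n ∸ 1) (λ i → p n i * b i (k ∸ 1))
  recurrence (suc n) (suc k) (s≤s k≥1) _ =
    ↔⇒≡ (↔-trans (b↔ (suc n) (suc k) (s≤s z≤n) (s≤s z≤n))
        (↔-trans (Chain-by-penultimate k≥1) (⨄↔Fin-sum n term)))
    where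
    term : ∀ i → 1 ≤ i → i ≤ n → (OfSize ∣_∣ₚ i × Chain i k) ↔ Fin (p (suc n) i * b i k)
    term i i≥1 i≤n =
      ↔-trans (ProperAP-of-size (s≤s i≤n) ×-↔ ↔-sym (b↔ i k i≥1 k≥1))
     (↔-trans (↔-sym (p↔ (suc n) i (s≤s z≤n)) ×-↔ ↔-refl) (↔-sym *↔×))
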